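{- For integers $a,b\ge 0$ with $b$ even, let $\ell(a,b)=\mathrm{LCS}\big((10)^{\langle a\rangle},(0110)^{\langle b\rangle}\big)$. Then \[ \ell(a,b)=\begin{cases} a & \text{if } a\le b/2,\\[2pt] \dfrac{b}{2}+\left\lfloor\dfrac{2a-b}{4}\right\rfloor & \text{if } \dfrac b2<a\le\dfrac{3b}{2},\\[4pt] b & \text{if } a>3b/2.\end{cases} \]
   Context: For a nonempty word $w$ and natural number $m$, $w^{\langle m\rangle}$ is the prefix of length $m$ of the infinite word $www\cdots$ (e.g. $(0110)^{\langle 3\rangle}=011$, and $w^{\langle 0\rangle}$ is the empty word). $\mathrm{LCS}(x,y)$ is the maximum length of a common subsequence of the binary words $x$ and $y$. -}

module Defs where

open import Data.Nat using (ℕ; zero; suc; _≤_)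
open import Data.Bool using (Bool; true; false)
open import Data.List using (List; []; _∷_; length)
open import Data.List.Relation.Binary.Sublist.Propositional using (_⊆_)
open import Data.Product using (Σ; _×_)
open import Data.List using (_++_)
open import Relation.Binary.PropositionalEquality using (_≡_)

-- binary words: letters 0 = false, 1 = true
Word : Set
Word = List Bool

-- w^⟨m⟩ : prefix of length m of www⋯ (for nonempty w = c ∷ cs)
-- cycPrefix w m with w given as (c ∷ cs); we cycle by rotating.
cycPrefix : Bool → List Bool → ℕ → Word
cycPrefix c cs zero = []
cycPrefix c [] (suc m) = c ∷ cycPrefix c [] m
cycPrefix c (d ∷ ds) (suc m) = c ∷ cycPrefix d (ds ++ (c ∷ [])) m

w10 : ℕ → Word
w10 = cycPrefix true (false ∷ [])

w0110 : ℕ → Word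
w0110 = cycPrefix false (true ∷ true ∷ false ∷ [])

CommonSubseq : Word → Word → Word → Set
CommonSubseq z x y = (z ⊆ x) × (z ⊆ y)

IsLCS : Word → Word → ℕ → Set
IsLCS x y n =
  Σ Word (λ z → CommonSubseq z x y × length z ≡ n) × ((z : Word) → CommonSubseq z x y → length z ≤ n)

-- Let altCost c z be the length of the shortest prefix of the alternating word c (not c) c ⋯
-- containing z as a subsequence, so that z ⊆ (10)^⟨a⟩ iff altCost true z ≤ a.  Inserting a letter
-- raises altCost by at most 2, hence altCost y + 2|z| ≤ altCost z + 2|y| whenever z ⊆ y.  As
-- altCost true (0110)^⟨2k⟩ = 3k, every common subsequence z of (10)^⟨a⟩ and (0110)^⟨2k⟩ has
-- 2|z| ≤ a + k.  Conversely, keeping 0110, 010 or 10 from each block 0110 yields common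
-- subsequences of length min(a, ⌊(a + k)/2⌋, 2k).
module Submission where

open import Defs
open import Data.Nat using (ℕ; _≤_; _<_; _*_; _+_; _∸_; _/_)
open import Data.Product using (_×_)
open import Data.Nat.Divisibility using (_∣_)

open import Data.Bool using (Bool; true; false; not)
open import Data.List using ([]; _∷_; length)
open import Data.List.Relation.Binary.Sublist.Propositional
  using (_⊆_; []; _∷_; _∷ʳ_; ⊆-refl; ⊆-trans; minimum)
open import Data.List.Relation.Binary.Sublist.Heterogeneous.Properties using (length-mono-≤)
open import Data.Nat using (zero; suc; z≤n; s≤s)
open import Data.Nat.DivMod using (m*n/n≡m; m/n*n≤m; /-monoˡ-≤; +-distrib-/-∣ˡ; m*n/m*o≡n/o)
open import Data.Nat.Divisibility using (divides; divides-refl)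
open import Data.Nat.Properties
open import Algebra.Properties.CommutativeSemigroup +-commutativeSemigroup
  using (interchange; x∙yz≈y∙xz)
open import Data.Nat.Tactic.RingSolver using (solve-∀)
open import Data.Product using (_,_; proj₁; proj₂)
open import Relation.Binary.PropositionalEquality

length-cycPrefix : ∀ c cs m → length (cycPrefix c cs m) ≡ m
length-cycPrefix c cs zero = refl
length-cycPrefix c [] (suc m) = cong suc (length-cycPrefix c [] m)
length-cycPrefix c (d ∷ ds) (suc m) = cong suc (length-cycPrefix d _ m)

cycPrefix-mono : ∀ c cs {m n} → m ≤ n → cycPrefix c cs m ⊆ cycPrefix c cs n
cycPrefix-mono c cs z≤n = minimum _
cycPrefix-mono c [] (s≤s m≤n) = refl ∷ cycPrefix-mono c [] m≤n
cycPrefix-mono c (d ∷ ds) (s≤s m≤n) = refl ∷ cycPrefix-mono d _ m≤n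

⊆⇒IsLCSˡ : ∀ {x y} → x ⊆ y → IsLCS x y (length x)
⊆⇒IsLCSˡ x⊆y = (_ , (⊆-refl , x⊆y) , refl) , λ z z⊆xy → length-mono-≤ (proj₁ z⊆xy)

⊆⇒IsLCSʳ : ∀ {x y} → y ⊆ x → IsLCS x y (length y)
⊆⇒IsLCSʳ y⊆x = (_ , (y⊆x , ⊆-refl) , refl) , λ z z⊆xy → length-mono-≤ (proj₂ z⊆xy)

alt : Bool → ℕ → Word
alt c = cycPrefix c (not c ∷ [])

altCost : Bool → Word → ℕ
altCost c [] = 0
altCost true (true ∷ z) = 1 + altCost false z
altCost true (false ∷ z) = 2 + altCost true z
altCost false (false ∷ z) = 1 + altCost true z
altCost false (true ∷ z) = 2 + altCost false z

altCost-not : ∀ c z → altCost (not c) z ≤ suc (altCost c z)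
altCost-not c [] = z≤n
altCost-not true (true ∷ z) = ≤-refl
altCost-not true (false ∷ z) = s≤s (m≤n+m _ 2)
altCost-not false (true ∷ z) = s≤s (m≤n+m _ 2)
altCost-not false (false ∷ z) = ≤-refl

altCost-∷ : ∀ c x z → altCost c (x ∷ z) ≤ 2 + altCost c z
altCost-∷ true true z = s≤s (altCost-not true z)
altCost-∷ true false z = ≤-refl
altCost-∷ false true z = ≤-refl
altCost-∷ false false z = s≤s (altCost-not false z)

⊆alt⇒altCost≤ : ∀ c n {z} → z ⊆ alt c n → altCost c z ≤ n
⊆alt⇒altCost≤ c zero [] = z≤n
⊆alt⇒altCost≤ true (suc n) {z} (.true ∷ʳ p) = ≤-trans (altCost-not false z) (s≤s (⊆alt⇒altCost≤ false n p))
⊆alt⇒altCost≤ false (suc n) {z} (.false ∷ʳ p) = ≤-trans (altCost-not true z) (s≤s (⊆alt⇒altCost≤ true n p))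
⊆alt⇒altCost≤ true (suc n) (refl ∷ p) = s≤s (⊆alt⇒altCost≤ false n p)
⊆alt⇒altCost≤ false (suc n) (refl ∷ p) = s≤s (⊆alt⇒altCost≤ true n p)

⊆alt-altCost : ∀ c z → z ⊆ alt c (altCost c z)
⊆alt-altCost c [] = []
⊆alt-altCost true (true ∷ z) = refl ∷ ⊆alt-altCost false z
⊆alt-altCost true (false ∷ z) = true ∷ʳ (refl ∷ ⊆alt-altCost true z)
⊆alt-altCost false (false ∷ z) = refl ∷ ⊆alt-altCost true z
⊆alt-altCost false (true ∷ z) = false ∷ʳ (refl ∷ ⊆alt-altCost false z)

altCost≤⇒⊆alt : ∀ c {z n} → altCost c z ≤ n → z ⊆ alt c n
altCost≤⇒⊆alt c {z} le = ⊆-trans (⊆alt-altCost c z) (cycPrefix-mono c _ le)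

+-interchange-mono : ∀ m n {a b c d} → a + b ≤ c + d → (m + a) + (n + b) ≤ (m + c) + (n + d)
+-interchange-mono m n {a} {b} {c} {d} le = begin
  (m + a) + (n + b) ≡⟨ interchange m a n b ⟩
  (m + n) + (a + b) ≤⟨ +-monoʳ-≤ (m + n) le ⟩
  (m + n) + (c + d) ≡⟨ interchange m n c d ⟩
  (m + c) + (n + d) ∎
  where open ≤-Reasoning

altCost-⊆ : ∀ c {z y} → z ⊆ y → altCost c y + length z * 2 ≤ altCost c z + length y * 2
altCost-⊆ c [] = z≤n
altCost-⊆ c {z} {x ∷ y} (.x ∷ʳ p) = begin
  altCost c (x ∷ y) + length z * 2  ≤⟨ +-monoˡ-≤ _ (altCost-∷ c x y) ⟩
  2 + (altCost c y + length z * 2)  ≤⟨ +-monoʳ-≤ 2 (altCost-⊆ c p) ⟩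
  2 + (altCost c z + length y * 2)  ≡⟨ x∙yz≈y∙xz 2 _ _ ⟩
  altCost c z + length (x ∷ y) * 2  ∎
  where open ≤-Reasoning
altCost-⊆ true {true ∷ _} (refl ∷ p) = +-interchange-mono 1 2 (altCost-⊆ false p)
altCost-⊆ true {false ∷ _} (refl ∷ p) = +-interchange-mono 2 2 (altCost-⊆ true p)
altCost-⊆ false {false ∷ _} (refl ∷ p) = +-interchange-mono 1 2 (altCost-⊆ true p)
altCost-⊆ false {true ∷ _} (refl ∷ p) = +-interchange-mono 2 2 (altCost-⊆ false p)

altCost-w0110 : ∀ k → altCost true (w0110 (k * 2)) ≡ k * 3
altCost-w0110 zero = refl
altCost-w0110 (suc zero) = refl
altCost-w0110 (suc (suc k)) = cong (6 +_) (altCost-w0110 k)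

commonSubseq-length : ∀ a k z → CommonSubseq z (w10 a) (w0110 (k * 2)) → length z * 2 ≤ a + k
commonSubseq-length a k z (z⊆x , z⊆y) = +-cancelˡ-≤ (k * 3) _ _ (begin
  k * 3 + length z * 2                           ≡⟨ cong (_+ length z * 2) (sym (altCost-w0110 k)) ⟩
  altCost true y + length z * 2                  ≤⟨ altCost-⊆ true z⊆y ⟩
  altCost true z + length y * 2                  ≤⟨ +-monoˡ-≤ _ (⊆alt⇒altCost≤ true a z⊆x) ⟩
  a + length y * 2                               ≡⟨ cong (λ n → a + n * 2) (length-cycPrefix _ _ (k * 2)) ⟩
  a + k * 2 * 2                                  ≡⟨ rearrange a k ⟩
  k * 3 + (a + k)                                ∎)
  where
  open ≤-Reasoning
  y : Word
  y = w0110 (k * 2)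
  rearrange : ∀ a k → a + k * 2 * 2 ≡ k * 3 + (a + k)
  rearrange = solve-∀

thinned : ℕ → ℕ → Word
thinned zero e = []
thinned (suc zero) zero = true ∷ []
thinned (suc zero) (suc e) = false ∷ true ∷ []
thinned (suc (suc k)) zero = true ∷ false ∷ thinned k zero
thinned (suc (suc k)) (suc zero) = false ∷ true ∷ false ∷ thinned k zero
thinned (suc (suc k)) (suc (suc e)) = false ∷ true ∷ true ∷ false ∷ thinned k e

thinned-⊆ : ∀ k e → thinned k e ⊆ w0110 (k * 2)
thinned-⊆ zero e = []
thinned-⊆ (suc zero) zero = false ∷ʳ (refl ∷ [])
thinned-⊆ (suc zero) (suc e) = refl ∷ refl ∷ []
thinned-⊆ (suc (suc k)) zero = false ∷ʳ (refl ∷ (true ∷ʳ (refl ∷ thinned-⊆ k zero)))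
thinned-⊆ (suc (suc k)) (suc zero) = refl ∷ refl ∷ (true ∷ʳ (refl ∷ thinned-⊆ k zero))
thinned-⊆ (suc (suc k)) (suc (suc e)) = refl ∷ refl ∷ refl ∷ refl ∷ thinned-⊆ k e

length-thinned : ∀ k e → e ≤ k → length (thinned k e) ≡ k + e
length-thinned zero .zero z≤n = refl
length-thinned (suc zero) zero _ = refl
length-thinned (suc zero) (suc zero) _ = refl
length-thinned (suc zero) (suc (suc e)) (s≤s ())
length-thinned (suc (suc k)) zero _ = cong (2 +_) (length-thinned k zero z≤n)
length-thinned (suc (suc k)) (suc zero) _ = cong (2 +_) (trans (cong suc (length-thinned k zero z≤n)) (sym (+-suc k 0)))
length-thinned (suc (suc k)) (suc (suc e)) (s≤s (s≤s e≤k)) =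
  cong (2 +_) (trans (cong (2 +_) (length-thinned k e e≤k)) (sym (+-suc-suc k e)))
  where
  +-suc-suc : ∀ m n → m + suc (suc n) ≡ 2 + (m + n)
  +-suc-suc m n = trans (+-suc m (suc n)) (cong suc (+-suc m n))

altCost-thinned : ∀ k e → altCost true (thinned k e) ≤ k + e * 2
altCost-thinned zero e = z≤n
altCost-thinned (suc zero) zero = ≤-refl
altCost-thinned (suc zero) (suc e) = s≤s (s≤s (s≤s z≤n))
altCost-thinned (suc (suc k)) zero = s≤s (s≤s (altCost-thinned k zero))
altCost-thinned (suc (suc k)) (suc zero) = begin
  4 + altCost true (thinned k zero) ≤⟨ +-monoʳ-≤ 4 (altCost-thinned k zero) ⟩
  4 + (k + 0)                       ≡⟨ cong (2 +_) (x∙yz≈y∙xz 2 k 0) ⟩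
  2 + k + 1 * 2                     ∎
  where open ≤-Reasoning
altCost-thinned (suc (suc k)) (suc (suc e)) = begin
  6 + altCost true (thinned k e) ≤⟨ +-monoʳ-≤ 6 (altCost-thinned k e) ⟩
  6 + (k + e * 2)                 ≡⟨ cong (2 +_) (x∙yz≈y∙xz 4 k (e * 2)) ⟩
  2 + k + (2 + e) * 2             ∎
  where open ≤-Reasoning

thinned-zero : ∀ k → thinned k zero ≡ w10 k
thinned-zero zero = refl
thinned-zero (suc zero) = refl
thinned-zero (suc (suc k)) = cong (λ w → true ∷ false ∷ w) (thinned-zero k)

triple-double : ∀ k → 3 * (k * 2) ≡ 2 * (k * 3)
triple-double = solve-∀

lcs-short : ∀ a b → 2 * a ≤ b → IsLCS (w10 a) (w0110 b) a
lcs-short a b 2a≤b = subst (IsLCS (w10 a) (w0110 b)) (length-cycPrefix _ _ a) (⊆⇒IsLCSˡ w10⊆w0110)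
  where
  w10⊆w0110 : w10 a ⊆ w0110 b
  w10⊆w0110 = ⊆-trans (subst (_⊆ w0110 (a * 2)) (thinned-zero a) (thinned-⊆ a zero))
                      (cycPrefix-mono false _ (subst (_≤ b) (*-comm 2 a) 2a≤b))

lcs-long : ∀ k a → 3 * (k * 2) < 2 * a → IsLCS (w10 a) (w0110 (k * 2)) (k * 2)
lcs-long k a h = subst (IsLCS (w10 a) (w0110 (k * 2))) (length-cycPrefix _ _ (k * 2)) (⊆⇒IsLCSʳ w0110⊆w10)
  where
  k*3≤a : k * 3 ≤ a
  k*3≤a = <⇒≤ (*-cancelˡ-< 2 _ _ (subst (_< 2 * a) (triple-double k) h))
  w0110⊆w10 : w0110 (k * 2) ⊆ w10 a
  w0110⊆w10 = altCost≤⇒⊆alt true (subst (_≤ a) (sym (altCost-w0110 k)) k*3≤a)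

lcs-middle : ∀ k d → d ≤ k * 2 → IsLCS (w10 (k + d)) (w0110 (k * 2)) (k + d / 2)
lcs-middle k d d≤k*2 = (z , (z⊆w10 , thinned-⊆ k (d / 2)) , length-thinned k (d / 2) d/2≤k) , maximal
  where
  open ≤-Reasoning
  z : Word
  z = thinned k (d / 2)
  d/2≤k : d / 2 ≤ k
  d/2≤k = ≤-trans (/-monoˡ-≤ 2 d≤k*2) (≤-reflexive (m*n/n≡m k 2))
  z⊆w10 : z ⊆ w10 (k + d)
  z⊆w10 = altCost≤⇒⊆alt true (≤-trans (altCost-thinned k (d / 2)) (+-monoʳ-≤ k (m/n*n≤m d 2)))
  maximal : ∀ z′ → CommonSubseq z′ (w10 (k + d)) (w0110 (k * 2)) → length z′ ≤ k + d / 2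
  maximal z′ common = begin
    length z′                ≡⟨ m*n/n≡m (length z′) 2 ⟨
    length z′ * 2 / 2        ≤⟨ /-monoˡ-≤ 2 (commonSubseq-length (k + d) k z′ common) ⟩
    (k + d + k) / 2          ≡⟨ cong (_/ 2) (rearrange k d) ⟩
    (k * 2 + d) / 2          ≡⟨ +-distrib-/-∣ˡ d (divides-refl k) ⟩
    k * 2 / 2 + d / 2        ≡⟨ cong (_+ d / 2) (m*n/n≡m k 2) ⟩
    k + d / 2                ∎
    where
    rearrange : ∀ k d → k + d + k ≡ k * 2 + d
    rearrange = solve-∀

lcs-between : ∀ k a → k * 2 < 2 * a → 2 * a ≤ 3 * (k * 2) →
  IsLCS (w10 a) (w0110 (k * 2)) (k * 2 / 2 + (2 * a ∸ k * 2) / 4)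
lcs-between k a h₁ h₂ =
  subst₂ (λ a n → IsLCS (w10 a) (w0110 (k * 2)) n) (m+[n∸m]≡n k≤a) (sym value) (lcs-middle k (a ∸ k) a∸k≤k*2)
  where
  k≤a : k ≤ a
  k≤a = <⇒≤ (*-cancelˡ-< 2 k a (subst (_< 2 * a) (*-comm k 2) h₁))
  a∸k≤k*2 : a ∸ k ≤ k * 2
  a∸k≤k*2 = begin
    a ∸ k          ≤⟨ ∸-monoˡ-≤ k (*-cancelˡ-≤ 2 (subst (2 * a ≤_) (triple-double k) h₂)) ⟩
    k * 3 ∸ k      ≡⟨ cong (_∸ k) (*-suc k 2) ⟩
    k + k * 2 ∸ k  ≡⟨ m+n∸m≡n k (k * 2) ⟩
    k * 2          ∎
    where open ≤-Reasoning
  value : k * 2 / 2 + (2 * a ∸ k * 2) / 4 ≡ k + (a ∸ k) / 2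
  value = cong₂ _+_ (m*n/n≡m k 2) (begin
    (2 * a ∸ k * 2) / 4    ≡⟨ cong (λ n → (2 * a ∸ n) / 4) (*-comm k 2) ⟩
    (2 * a ∸ 2 * k) / 4    ≡⟨ cong (_/ 4) (*-distribˡ-∸ 2 a k) ⟨
    2 * (a ∸ k) / (2 * 2)  ≡⟨ m*n/m*o≡n/o 2 (a ∸ k) 2 ⟩
    (a ∸ k) / 2            ∎)
    where open ≡-Reasoning

lemmaA2 : (a b : ℕ) → 2 ∣ b →
    (2 * a ≤ b → IsLCS (w10 a) (w0110 b) a) ×
    (b < 2 * a → 2 * a ≤ 3 * b → IsLCS (w10 a) (w0110 b) (b / 2 + (2 * a ∸ b) / 4)) ×
    (3 * b < 2 * a → IsLCS (w10 a) (w0110 b) b)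
lemmaA2 a .(k * 2) (divides k refl) = lcs-short a (k * 2) , lcs-between k a , lcs-long k a
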